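{- Let $\mathcal N,\mathcal M$ be models of $\mathcal{AX}_{\mathtt{diff}}$ such that $\mathcal M$ is a substructure of $\mathcal N$. Then for every $a,b\in\mathtt{ARRAY}^{\mathcal M}$ we have $\mathcal M\models|a-b|<\omega$ if and only if $\mathcal N\models|a-b|<\omega$.
   Context: $\mathcal{AX}_{\mathtt{diff}}$ is the many-sorted first-order theory with equality having sorts $\mathtt{ARRAY},\mathtt{INDEX},\mathtt{ELEM}$, function symbols $rd:\mathtt{ARRAY}\times\mathtt{INDEX}\to\mathtt{ELEM}$, $wr:\mathtt{ARRAY}\times\mathtt{INDEX}\times\mathtt{ELEM}\to\mathtt{ARRAY}$, $\mathtt{diff}:\mathtt{ARRAY}\times\mathtt{ARRAY}\to\mathtt{INDEX}$, and axioms $\forall y,i,e.\ rd(wr(y,i,e),i)=e$; $\forall y,i,j,e.\ i\neq j\Rightarrow rd(wr(y,i,e),j)=rd(y,j)$; $\forall x,y.\ x\neq y\Rightarrow rd(x,\mathtt{diff}(x,y))\neq rd(y,\mathtt{diff}(x,y))$. For a model $\mathcal M$ and $a,b\in\mathtt{ARRAY}^{\mathcal M}$, $a$ and $b$ are cardinality dependent, written $\mathcal M\models|a-b|<\omega$, iff the set $\{i\in\mathtt{INDEX}^{\mathcal M}\mid rd^{\mathcal M}(a,i)\neq rd^{\mathcal M}(b,i)\}$ is finite. -}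

module Defs where

open import Level using (Level; suc; _⊔_)
open import Data.Product using (Σ; ∃; _×_; _,_)
open import Data.List using (List)
open import Data.List.Membership.Propositional using (_∈_)
open import Relation.Binary.PropositionalEquality using (_≡_; _≢_)
open import Function.Definitions using (Injective)

-- A structure for the signature of AX_diff (three sorts, rd, wr, diff),
-- with equality interpreted as propositional equality on the carriers.
record Structure : Set₁ where
  field
    ARRAY : Set
    INDEX : Set
    ELEM  : Set
    rd    : ARRAY → INDEX → ELEM
    wr    : ARRAY → INDEX → ELEM → ARRAY
    diff  : ARRAY → ARRAY → INDEX

record IsModel (M : Structure) : Set where
  open Structure M
  field
    rd-wr-same  : ∀ (y : ARRAY) (i : INDEX) (e : ELEM) → rd (wr y i e) i ≡ e
    rd-wr-other : ∀ (y : ARRAY) (i j : INDEX) (e : ELEM) → i ≢ j → rd (wr y i e) j ≡ rd y j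
    ext-diff    : ∀ (x y : ARRAY) → x ≢ y → rd x (diff x y) ≢ rd y (diff x y)

record Model : Set₁ where
  field
    structure : Structure
    isModel   : IsModel structure
  open Structure structure public

-- M is a substructure of N: sortwise injective inclusion maps commuting
-- with all function symbols (i.e. an embedding of M into N).
record Substructure (M N : Structure) : Set where
  private
    module M = Structure M
    module N = Structure N
  field
    ιA : M.ARRAY → N.ARRAY
    ιI : M.INDEX → N.INDEX
    ιE : M.ELEM  → N.ELEM
    ιA-inj : Injective _≡_ _≡_ ιA
    ιI-inj : Injective _≡_ _≡_ ιI
    ιE-inj : Injective _≡_ _≡_ ιE
    pres-rd   : ∀ a i → ιE (M.rd a i) ≡ N.rd (ιA a) (ιI i)
    pres-wr   : ∀ a i e → ιA (M.wr a i e) ≡ N.wr (ιA a) (ιI i) (ιE e)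
    pres-diff : ∀ a b → ιI (M.diff a b) ≡ N.diff (ιA a) (ιA b)

FiniteSubset : {A : Set} → (A → Set) → Set
FiniteSubset {A} P = Σ (List A) λ L → ∀ x → P x → x ∈ L

-- M ⊨ |a - b| < ω : the set {i | rd a i ≠ rd b i} is finite.
CardDep : (M : Structure) → Structure.ARRAY M → Structure.ARRAY M → Set
CardDep M a b = FiniteSubset (λ i → rd a i ≢ rd b i)
  where open Structure M

-- An array b that differs from a at finitely many indices i₁ … iₙ is the term
-- wr(… wr(a, i₁, rd(b, i₁)) …, iₙ, rd(b, iₙ)) (by extensionality, via diff).
-- An embedding preserves this term, and in N the term differs from ι a at most
-- at ι i₁ … ι iₙ.  Conversely, since the embedding preserves rd and is
-- injective, every index of M where a and b differ maps to one where ι a and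
-- ι b differ, and an injective map has finite preimages of finite sets.
module Submission where

open import Defs
open import Axiom.ExcludedMiddle using (ExcludedMiddle)
open import Level using (0ℓ)
open import Function.Base using (_∘_)
open import Function.Bundles using (_⇔_; mk⇔)
open import Function.Definitions using (Injective)
open import Data.Product using (∃; _,_)
open import Data.List using (List; []; _∷_; map)
open import Data.List.Relation.Unary.Any using (here; there)
open import Data.List.Membership.Propositional using (_∈_; _∉_)
open import Relation.Binary.PropositionalEquality
open import Relation.Nullary using (yes; no; contradiction)
open import Relation.Nullary.Decidable using (decidable-stable)

FiniteSubset-mono : {A : Set} {P Q : A → Set} →
  (∀ x → Q x → P x) → FiniteSubset P → FiniteSubset Q
FiniteSubset-mono Q⊆P (L , cover) = L , λ x → cover x ∘ Q⊆P x

module _ (em : ExcludedMiddle 0ℓ) {A B : Set} (f : A → B) where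

  preimage : List B → List A
  preimage [] = []
  preimage (y ∷ ys) with em {∃ λ x → f x ≡ y}
  ... | yes (x , _) = x ∷ preimage ys
  ... | no _        = preimage ys

  ∈-preimage : Injective _≡_ _≡_ f → ∀ {x} ys → f x ∈ ys → x ∈ preimage ys
  ∈-preimage f-inj {x} (y ∷ ys) x∈ys with em {∃ λ x → f x ≡ y} | x∈ys
  ... | yes (x′ , fx′≡y) | here fx≡y   = here (f-inj (trans fx≡y (sym fx′≡y)))
  ... | yes _            | there x∈ys′ = there (∈-preimage f-inj ys x∈ys′)
  ... | no ∄x            | here fx≡y   = contradiction (x , fx≡y) ∄x
  ... | no _             | there x∈ys′ = ∈-preimage f-inj ys x∈ys′

  FiniteSubset-preimage : Injective _≡_ _≡_ f → {P : B → Set} →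
    FiniteSubset P → FiniteSubset (P ∘ f)
  FiniteSubset-preimage f-inj (L , cover) =
    preimage L , λ x → ∈-preimage f-inj L ∘ cover (f x)

overwrite : (M : Structure) → Structure.ARRAY M → Structure.ARRAY M →
  List (Structure.INDEX M) → Structure.ARRAY M
overwrite M a b []       = a
overwrite M a b (i ∷ is) = wr (overwrite M a b is) i (rd b i)
  where open Structure M

module _ (M : Model) where
  open Model M
  open IsModel isModel

  rd-overwrite-∉ : ∀ a b {i} is → i ∉ is → rd (overwrite structure a b is) i ≡ rd a i
  rd-overwrite-∉ a b []       i∉is = refl
  rd-overwrite-∉ a b (j ∷ is) i∉is =
    trans (rd-wr-other _ j _ _ (λ j≡i → i∉is (here (sym j≡i))))
          (rd-overwrite-∉ a b is (i∉is ∘ there))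

  module _ (em : ExcludedMiddle 0ℓ) where

    rd-overwrite-∈ : ∀ a b {i} is → i ∈ is → rd (overwrite structure a b is) i ≡ rd b i
    rd-overwrite-∈ a b (j ∷ is) (here refl) = rd-wr-same _ j _
    rd-overwrite-∈ a b {i} (j ∷ is) (there i∈is) with em {j ≡ i}
    ... | yes refl = rd-wr-same _ j _
    ... | no j≢i   = trans (rd-wr-other _ j i _ j≢i) (rd-overwrite-∈ a b is i∈is)

    array-ext : ∀ {x y} → (∀ i → rd x i ≡ rd y i) → x ≡ y
    array-ext {x} {y} x≗y with em {x ≡ y}
    ... | yes x≡y = x≡y
    ... | no x≢y  = contradiction (x≗y (diff x y)) (ext-diff x y x≢y)

    overwrite-covering : ∀ a b is → (∀ i → rd a i ≢ rd b i → i ∈ is) →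
      overwrite structure a b is ≡ b
    overwrite-covering a b is cover = array-ext pointwise
      where
      pointwise : ∀ i → rd (overwrite structure a b is) i ≡ rd b i
      pointwise i with em {i ∈ is}
      ... | yes i∈is = rd-overwrite-∈ a b is i∈is
      ... | no i∉is  = trans (rd-overwrite-∉ a b is i∉is)
                             (decidable-stable em (i∉is ∘ cover i))

    CardDep-overwrite : ∀ a b is → CardDep structure a (overwrite structure a b is)
    CardDep-overwrite a b is = is , λ i a≢ → decidable-stable em
      (λ i∉is → a≢ (sym (rd-overwrite-∉ a b is i∉is)))

module _ {M N : Structure} (S : Substructure M N) where
  private
    module M = Structure M
    module N = Structure N
  open Substructure S

  ιA-overwrite : ∀ a b is →
    ιA (overwrite M a b is) ≡ overwrite N (ιA a) (ιA b) (map ιI is)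
  ιA-overwrite a b []       = refl
  ιA-overwrite a b (i ∷ is) = begin
    ιA (M.wr (overwrite M a b is) i (M.rd b i))
      ≡⟨ pres-wr _ i _ ⟩
    N.wr (ιA (overwrite M a b is)) (ιI i) (ιE (M.rd b i))
      ≡⟨ cong₂ (λ c e → N.wr c (ιI i) e) (ιA-overwrite a b is) (pres-rd b i) ⟩
    N.wr (overwrite N (ιA a) (ιA b) (map ιI is)) (ιI i) (N.rd (ιA b) (ιI i))
      ∎
    where open ≡-Reasoning

  ι-rd-≢ : ∀ a b i → M.rd a i ≢ M.rd b i → N.rd (ιA a) (ιI i) ≢ N.rd (ιA b) (ιI i)
  ι-rd-≢ a b i a≢b ιa≡ιb =
    a≢b (ιE-inj (trans (pres-rd a i) (trans ιa≡ιb (sym (pres-rd b i)))))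

lemma3p1 : ExcludedMiddle 0ℓ →
    (N M : Model) →
    (S : Substructure (Model.structure M) (Model.structure N)) →
    (a b : Model.ARRAY M) →
    CardDep (Model.structure M) a b
      ⇔ CardDep (Model.structure N) (Substructure.ιA S a) (Substructure.ιA S b)
lemma3p1 em N M S a b = mk⇔ forward backward
  where
  open Substructure S

  forward : CardDep (Model.structure M) a b →
            CardDep (Model.structure N) (ιA a) (ιA b)
  forward (is , cover) =
    subst (CardDep (Model.structure N) (ιA a)) ιb≡overwrite
          (CardDep-overwrite N em (ιA a) (ιA b) (map ιI is))
    where
    ιb≡overwrite : overwrite (Model.structure N) (ιA a) (ιA b) (map ιI is) ≡ ιA b
    ιb≡overwrite = trans (sym (ιA-overwrite S a b is))
                         (cong ιA (overwrite-covering M em a b is cover))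

  backward : CardDep (Model.structure N) (ιA a) (ιA b) →
             CardDep (Model.structure M) a b
  backward = FiniteSubset-mono (ι-rd-≢ S a b) ∘ FiniteSubset-preimage em ιI ιI-inj
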